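{- For any pair of finite simple graphs $X$ and $Y$, \[ \gamma (X\square Y\square P_2)\geq \frac{2}{3}\gamma (X)\gamma (Y). \]
   Context: $\gamma(G)$ denotes the domination number of a graph $G$ (the minimum size of a set $S\subseteq V(G)$ such that every vertex of $G$ is in $S$ or adjacent to a vertex of $S$). $X\square Y$ denotes the Cartesian product of graphs: vertex set $V(X)\times V(Y)$, with $(x_1,y_1)$ adjacent to $(x_2,y_2)$ iff either $x_1=x_2$ and $y_1y_2\in E(Y)$, or $y_1=y_2$ and $x_1x_2\in E(X)$. $P_n$ is the path graph on $n$ vertices. -}

module Defs where

open import Data.Nat using (ℕ; _*_; _≤_)
open import Data.Fin using (Fin; quotient; remainder; zero; suc)
open import Data.Fin.Subset using (Subset; _∈_; ∣_∣)
open import Data.Product using (Σ; ∃; _×_; _,_)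
open import Data.Sum using (_⊎_)
open import Relation.Binary.PropositionalEquality using (_≡_)
open import Relation.Nullary using (¬_)

record Graph : Set₁ where
  field
    n    : ℕ
    Adj  : Fin n → Fin n → Set
    irrefl : ∀ u → ¬ Adj u u
    symm : ∀ u v → Adj u v → Adj v u
open Graph public

Dominating : (G : Graph) → Subset (n G) → Set
Dominating G S = ∀ v → v ∈ S ⊎ Σ (Fin (n G)) (λ u → u ∈ S × Adj G u v)

IsDominationNumber : Graph → ℕ → Set
IsDominationNumber G k =
  Σ (Subset (n G)) (λ S → Dominating G S × ∣ S ∣ ≡ k)
  × (∀ S → Dominating G S → k ≤ ∣ S ∣)

-- A vertex (x , y) of V(X) × V(Y) is encoded as
-- combine x y : Fin (n X * n Y); its coordinates are recovered by fstV / sndV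
-- (Data.Fin.quotient / remainder, inverse to combine).
fstV : (X Y : Graph) → Fin (n X * n Y) → Fin (n X)
fstV X Y = quotient {n X} (n Y)

sndV : (X Y : Graph) → Fin (n X * n Y) → Fin (n Y)
sndV X Y = remainder {n X} (n Y)

□Adj : (X Y : Graph) → Fin (n X * n Y) → Fin (n X * n Y) → Set
□Adj X Y a b =
  (fstV X Y a ≡ fstV X Y b × Adj Y (sndV X Y a) (sndV X Y b))
  ⊎ (sndV X Y a ≡ sndV X Y b × Adj X (fstV X Y a) (fstV X Y b))

_□_ : Graph → Graph → Graph
X □ Y = record { n = n X * n Y ; Adj = □Adj X Y ; irrefl = irr ; symm = sy }
  where
    open import Data.Sum using (inj₁; inj₂)
    open import Relation.Binary.PropositionalEquality using () renaming (sym to ≡sym)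
    irr : ∀ a → ¬ □Adj X Y a a
    irr a (inj₁ (_ , p)) = irrefl Y _ p
    irr a (inj₂ (_ , p)) = irrefl X _ p
    sy : ∀ a b → □Adj X Y a b → □Adj X Y b a
    sy a b (inj₁ (e , p)) = inj₁ (≡sym e , symm Y _ _ p)
    sy a b (inj₂ (e , p)) = inj₂ (≡sym e , symm X _ _ p)

infixl 7 _□_

PathAdj : ∀ {m} → Fin m → Fin m → Set
PathAdj i j = suc' (toℕ i) ≡ toℕ j ⊎ suc' (toℕ j) ≡ toℕ i
  where open import Data.Nat using () renaming (suc to suc')
        open import Data.Fin using (toℕ)

P : ℕ → Graph
P m = record { n = m ; Adj = PathAdj ; irrefl = irr ; symm = sy }
  where
    open import Data.Sum using (inj₁; inj₂)
    open import Data.Nat.Properties using (1+n≢n)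
    open import Relation.Binary.PropositionalEquality using (sym)
    irr : ∀ u → ¬ PathAdj u u
    irr u (inj₁ e) = 1+n≢n e
    irr u (inj₂ e) = 1+n≢n e
    sy : ∀ u v → PathAdj u v → PathAdj v u
    sy u v (inj₁ e) = inj₂ e
    sy u v (inj₂ e) = inj₁ e

module Submission where

-- Fix a minimum dominating set S of X and send every x to a centre π(x) ∈ S dominating it;
-- the cells π⁻¹(c) partition X.  A vertex (x, y, l) of X □ Y □ Z is fibre-dominated when a
-- dominating set D reaches it from its own fibre {x} × Y × Z, and X-dominated otherwise.
-- For a centre c, the y lying under some vertex of D in the cell of c, together with the y over
-- which the whole cell is X-dominated, dominate Y.  For a layer (y, l), the x with (x, y, l) ∈ D,
-- together with the centres whose cell is not entirely X-dominated over y, dominate X.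
-- If q counts the pairs (c, y) with the cell of c entirely X-dominated over y, the first family
-- gives γ(X) γ(Y) ≤ |D| + q and the second gives |Z| q ≤ |D|, so
-- |Z| γ(X) γ(Y) ≤ (|Z| + 1) |D| for every graph Z.

open import Defs

open import Data.Bool using (Bool; true; false; _∨_; _∧_; not)
open import Data.Bool.Properties using (∨-zeroʳ; ∧-conicalˡ; ∧-conicalʳ)
open import Data.Fin using (Fin; zero; suc; combine; _↑ˡ_; _↑ʳ_)
open import Data.Fin.Properties using (_≟_; remQuot-combine; combine-remQuot; combine-injective)
open import Data.Fin.Subset using (Subset; ∣_∣; _∈_)
open import Data.Nat using (ℕ; zero; suc; _+_; _*_; _≤_; z≤n; s≤s)
open import Data.Nat.Properties
  using ( +-*-semiring; +-assoc; +-comm; +-identityʳ; *-identityˡ; *-distribˡ-+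
        ; ≤-refl; +-mono-≤; +-monoˡ-≤; +-monoʳ-≤; *-monoʳ-≤; +-cancelˡ-≤
        ; module ≤-Reasoning)
open import Data.Product using (∃; ∃₂; _×_; _,_; proj₁; proj₂)
open import Data.Sum using (_⊎_; inj₁; inj₂)
open import Data.Vec using (_∷_; []; lookup; tabulate)
open import Data.Vec.Properties using (lookup∘tabulate; lookup⇒[]=; []=⇒lookup)
open import Function using (_∘_)
open import Relation.Binary.PropositionalEquality
open import Relation.Nullary using (does; contradiction)
open import Relation.Nullary.Decidable using (dec-true)

open import Algebra.Properties.Semiring.Sum +-*-semiring
  using ( sum; sum-syntax; ∑-comm; ∑-distrib-+; *-distribˡ-sum; *-distribʳ-sum
        ; sum-cong-≗; sum-replicate-zero)

∑-mono-≤ : ∀ {n} {f g : Fin n → ℕ} → (∀ i → f i ≤ g i) → sum f ≤ sum g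
∑-mono-≤ {zero}  f≤g = z≤n
∑-mono-≤ {suc n} f≤g = +-mono-≤ (f≤g zero) (∑-mono-≤ (f≤g ∘ suc))

∑-const : ∀ n c → ∑[ i < n ] c ≡ n * c
∑-const zero    c = refl
∑-const (suc n) c = cong (c +_) (∑-const n c)

∑-↑ : ∀ m n (f : Fin (m + n) → ℕ) →
      sum f ≡ ∑[ i < m ] f (i ↑ˡ n) + ∑[ j < n ] f (m ↑ʳ j)
∑-↑ zero    n f = refl
∑-↑ (suc m) n f = trans (cong (f zero +_) (∑-↑ m n (f ∘ suc))) (sym (+-assoc (f zero) _ _))

∑-combine : ∀ m n (f : Fin (m * n) → ℕ) →
            sum f ≡ ∑[ i < m ] ∑[ j < n ] f (combine i j)
∑-combine zero    n f = refl
∑-combine (suc m) n f =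
  trans (∑-↑ n (m * n) f) (cong (sum (λ j → f (j ↑ˡ m * n)) +_) (∑-combine m n (f ∘ (n ↑ʳ_))))

𝟙 : Bool → ℕ
𝟙 true  = 1
𝟙 false = 0

∨-trueˡ : ∀ {x} y → x ≡ true → x ∨ y ≡ true
∨-trueˡ y refl = refl

∨-trueʳ : ∀ x {y} → y ≡ true → x ∨ y ≡ true
∨-trueʳ x refl = ∨-zeroʳ x

∧-true : ∀ {x y} → x ≡ true → y ≡ true → x ∧ y ≡ true
∧-true refl refl = refl

𝟙-∨-≤ : ∀ x y → 𝟙 (x ∨ y) ≤ 𝟙 x + 𝟙 y
𝟙-∨-≤ true  y = s≤s z≤n
𝟙-∨-≤ false y = ≤-refl

𝟙-∧ : ∀ x y → 𝟙 (x ∧ y) ≡ 𝟙 x * 𝟙 y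
𝟙-∧ true  y = sym (+-identityʳ (𝟙 y))
𝟙-∧ false y = refl

𝟙-split : ∀ x y → 𝟙 x ≡ 𝟙 (x ∧ y) + 𝟙 (x ∧ not y)
𝟙-split true  true  = refl
𝟙-split true  false = refl
𝟙-split false y     = refl

∑𝟙≟≡1 : ∀ {n} (i : Fin n) → ∑[ j < n ] 𝟙 (does (i ≟ j)) ≡ 1
∑𝟙≟≡1 {suc n} zero    = cong suc (sum-replicate-zero n)
∑𝟙≟≡1 {suc n} (suc i) = ∑𝟙≟≡1 i

any : ∀ {n} → (Fin n → Bool) → Bool
any {zero}  f = false
any {suc n} f = f zero ∨ any (f ∘ suc)

any⁺ : ∀ {n} (f : Fin n → Bool) i → f i ≡ true → any f ≡ true
any⁺ f zero    fi = cong (_∨ any (f ∘ suc)) fi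
any⁺ f (suc i) fi with f zero
... | true  = refl
... | false = any⁺ (f ∘ suc) i fi

any⁻ : ∀ {n} (f : Fin n → Bool) → any f ≡ true → ∃ λ i → f i ≡ true
any⁻ {suc n} f any≡true with f zero in f0
... | true  = zero , f0
... | false with any⁻ (f ∘ suc) any≡true
...   | i , fi = suc i , fi

𝟙-any-≤ : ∀ {n} (f : Fin n → Bool) → 𝟙 (any f) ≤ ∑[ i < n ] 𝟙 (f i)
𝟙-any-≤ {zero}  f = z≤n
𝟙-any-≤ {suc n} f with f zero
... | true  = s≤s z≤n
... | false = 𝟙-any-≤ (f ∘ suc)

∑-image-≤ : ∀ {a c} (π : Fin a → Fin c) (f : Fin a → Bool) →
            ∑[ j < c ] 𝟙 (any λ i → does (π i ≟ j) ∧ f i) ≤ ∑[ i < a ] 𝟙 (f i)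
∑-image-≤ {a} {c} π f = begin
  ∑[ j < c ] 𝟙 (any λ i → does (π i ≟ j) ∧ f i)
    ≤⟨ ∑-mono-≤ (λ j → 𝟙-any-≤ (λ i → does (π i ≟ j) ∧ f i)) ⟩
  ∑[ j < c ] ∑[ i < a ] 𝟙 (does (π i ≟ j) ∧ f i)
    ≡⟨ ∑-comm (λ j i → 𝟙 (does (π i ≟ j) ∧ f i)) ⟩
  ∑[ i < a ] ∑[ j < c ] 𝟙 (does (π i ≟ j) ∧ f i)
    ≡⟨ sum-cong-≗ ∑-fibre ⟩
  ∑[ i < a ] 𝟙 (f i) ∎
  where
  open ≤-Reasoning
  ∑-fibre : ∀ i → ∑[ j < c ] 𝟙 (does (π i ≟ j) ∧ f i) ≡ 𝟙 (f i)
  ∑-fibre i = ≡.begin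
    ∑[ j < c ] 𝟙 (does (π i ≟ j) ∧ f i)
      ≡.≡⟨ sum-cong-≗ (λ j → 𝟙-∧ (does (π i ≟ j)) (f i)) ⟩
    ∑[ j < c ] (𝟙 (does (π i ≟ j)) * 𝟙 (f i))
      ≡.≡⟨ *-distribʳ-sum (𝟙 (f i)) (λ j → 𝟙 (does (π i ≟ j))) ⟨
    (∑[ j < c ] 𝟙 (does (π i ≟ j))) * 𝟙 (f i)
      ≡.≡⟨ cong (_* 𝟙 (f i)) (∑𝟙≟≡1 (π i)) ⟩
    1 * 𝟙 (f i)
      ≡.≡⟨ *-identityˡ (𝟙 (f i)) ⟩
    𝟙 (f i) ≡.∎
    where module ≡ = ≡-Reasoning

∣p∣≡∑𝟙 : ∀ {n} (p : Subset n) → ∣ p ∣ ≡ ∑[ i < n ] 𝟙 (lookup p i)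
∣p∣≡∑𝟙 []          = refl
∣p∣≡∑𝟙 (true  ∷ p) = cong suc (∣p∣≡∑𝟙 p)
∣p∣≡∑𝟙 (false ∷ p) = ∣p∣≡∑𝟙 p

∣tabulate∣≡∑𝟙 : ∀ {n} (f : Fin n → Bool) → ∣ tabulate f ∣ ≡ ∑[ i < n ] 𝟙 (f i)
∣tabulate∣≡∑𝟙 f = trans (∣p∣≡∑𝟙 (tabulate f)) (sum-cong-≗ (cong 𝟙 ∘ lookup∘tabulate f))

∣tabulate-∨∣≤ : ∀ {n} (f g : Fin n → Bool) →
                ∣ tabulate (λ i → f i ∨ g i) ∣ ≤ ∑[ i < n ] 𝟙 (f i) + ∑[ i < n ] 𝟙 (g i)
∣tabulate-∨∣≤ f g = begin
  ∣ tabulate (λ i → f i ∨ g i) ∣  ≡⟨ ∣tabulate∣≡∑𝟙 (λ i → f i ∨ g i) ⟩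
  sum (λ i → 𝟙 (f i ∨ g i))       ≤⟨ ∑-mono-≤ (λ i → 𝟙-∨-≤ (f i) (g i)) ⟩
  sum (λ i → 𝟙 (f i) + 𝟙 (g i))   ≡⟨ ∑-distrib-+ (𝟙 ∘ f) (𝟙 ∘ g) ⟩
  sum (𝟙 ∘ f) + sum (𝟙 ∘ g)       ∎
  where open ≤-Reasoning

∈-tabulate⁺ : ∀ {n} (f : Fin n → Bool) {i} → f i ≡ true → i ∈ tabulate f
∈-tabulate⁺ f {i} fi = lookup⇒[]= i (tabulate f) (trans (lookup∘tabulate f i) fi)

module Counting {a b m : ℕ}
  (inD : Fin a → Fin b → Fin m → Bool)
  (inS : Fin a → Bool)
  (centre : Fin a → Fin a)
  (cellFibreDominated : Fin a → Fin b → Bool)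
  where

  open ≤-Reasoning

  occupied : Fin a → Fin b → Bool
  occupied x y = any (inD x y)

  cellOccupied : Fin a → Fin b → Bool
  cellOccupied c y = any λ x → does (centre x ≟ c) ∧ occupied x y

  fibreCentre : Fin a → Fin b → Bool
  fibreCentre c y = inS c ∧ cellFibreDominated c y

  xCentre : Fin a → Fin b → Bool
  xCentre c y = inS c ∧ not (cellFibreDominated c y)

  Ydom : Fin a → Subset b
  Ydom c = tabulate λ y → cellOccupied c y ∨ not (cellFibreDominated c y)

  Xdom : Fin b → Fin m → Subset a
  Xdom y l = tabulate λ x → inD x y l ∨ fibreCentre x y

  #D : ℕ
  #D = ∑[ x < a ] ∑[ y < b ] ∑[ l < m ] 𝟙 (inD x y l)

  #cellOccupied : Fin a → ℕ
  #cellOccupied c = ∑[ y < b ] 𝟙 (cellOccupied c y)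

  #fibreCentres : Fin b → ℕ
  #fibreCentres y = ∑[ c < a ] 𝟙 (fibreCentre c y)

  #xCentres : Fin b → ℕ
  #xCentres y = ∑[ c < a ] 𝟙 (xCentre c y)

  ∑#cellOccupied≤#D : ∑[ c < a ] #cellOccupied c ≤ #D
  ∑#cellOccupied≤#D = begin
    ∑[ c < a ] ∑[ y < b ] 𝟙 (cellOccupied c y)
      ≡⟨ ∑-comm (λ c y → 𝟙 (cellOccupied c y)) ⟩
    ∑[ y < b ] ∑[ c < a ] 𝟙 (cellOccupied c y)
      ≤⟨ ∑-mono-≤ (λ y → ∑-image-≤ centre (λ x → occupied x y)) ⟩
    ∑[ y < b ] ∑[ x < a ] 𝟙 (occupied x y)
      ≤⟨ ∑-mono-≤ (λ y → ∑-mono-≤ (λ x → 𝟙-any-≤ (inD x y))) ⟩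
    ∑[ y < b ] ∑[ x < a ] ∑[ l < m ] 𝟙 (inD x y l)
      ≡⟨ ∑-comm (λ y x → ∑[ l < m ] 𝟙 (inD x y l)) ⟩
    #D ∎

  ∑𝟙inS-split : ∀ y → ∑[ c < a ] 𝟙 (inS c) ≡ #fibreCentres y + #xCentres y
  ∑𝟙inS-split y = trans (sum-cong-≗ (λ c → 𝟙-split (inS c) (cellFibreDominated c y)))
                        (∑-distrib-+ (λ c → 𝟙 (fibreCentre c y)) (λ c → 𝟙 (xCentre c y)))

  module _ {k g : ℕ} (∑𝟙inS≡k : ∑[ c < a ] 𝟙 (inS c) ≡ k)
           (g≤∣Ydom∣ : ∀ c → inS c ≡ true → g ≤ ∣ Ydom c ∣)
           (k≤∣Xdom∣ : ∀ y l → k ≤ ∣ Xdom y l ∣) where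

    𝟙inS*g≤ : ∀ c → 𝟙 (inS c) * g ≤ #cellOccupied c + ∑[ y < b ] 𝟙 (xCentre c y)
    𝟙inS*g≤ c with inS c in c∈S
    ... | false = z≤n
    ... | true  = begin
      g + 0       ≡⟨ +-identityʳ g ⟩
      g           ≤⟨ g≤∣Ydom∣ c c∈S ⟩
      ∣ Ydom c ∣  ≤⟨ ∣tabulate-∨∣≤ (cellOccupied c) (not ∘ cellFibreDominated c) ⟩
      _           ∎

    k*g≤#D+∑#xCentres : k * g ≤ #D + ∑[ y < b ] #xCentres y
    k*g≤#D+∑#xCentres = begin
      k * g                                ≡⟨ cong (_* g) ∑𝟙inS≡k ⟨
      (∑[ c < a ] 𝟙 (inS c)) * g           ≡⟨ *-distribʳ-sum g (𝟙 ∘ inS) ⟩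
      ∑[ c < a ] (𝟙 (inS c) * g)           ≤⟨ ∑-mono-≤ 𝟙inS*g≤ ⟩
      ∑[ c < a ] (#cellOccupied c + ∑[ y < b ] 𝟙 (xCentre c y))
        ≡⟨ ∑-distrib-+ #cellOccupied (λ c → ∑[ y < b ] 𝟙 (xCentre c y)) ⟩
      ∑[ c < a ] #cellOccupied c + ∑[ c < a ] ∑[ y < b ] 𝟙 (xCentre c y)
        ≡⟨ cong (∑[ c < a ] #cellOccupied c +_) (∑-comm (λ c y → 𝟙 (xCentre c y))) ⟩
      ∑[ c < a ] #cellOccupied c + ∑[ y < b ] #xCentres y
        ≤⟨ +-monoˡ-≤ _ ∑#cellOccupied≤#D ⟩
      #D + ∑[ y < b ] #xCentres y          ∎

    #xCentres≤#layer : ∀ y l → #xCentres y ≤ ∑[ x < a ] 𝟙 (inD x y l)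
    #xCentres≤#layer y l = +-cancelˡ-≤ (#fibreCentres y) _ _ (begin
      #fibreCentres y + #xCentres y  ≡⟨ ∑𝟙inS-split y ⟨
      ∑[ c < a ] 𝟙 (inS c)           ≡⟨ ∑𝟙inS≡k ⟩
      k                              ≤⟨ k≤∣Xdom∣ y l ⟩
      ∣ Xdom y l ∣                   ≤⟨ ∣tabulate-∨∣≤ (λ x → inD x y l) (λ x → fibreCentre x y) ⟩
      #layer + #fibreCentres y       ≡⟨ +-comm #layer (#fibreCentres y) ⟩
      #fibreCentres y + #layer       ∎)
      where
      #layer : ℕ
      #layer = ∑[ x < a ] 𝟙 (inD x y l)

    m*∑#xCentres≤#D : m * ∑[ y < b ] #xCentres y ≤ #D
    m*∑#xCentres≤#D = begin
      m * ∑[ y < b ] #xCentres y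
        ≡⟨ *-distribˡ-sum m #xCentres ⟩
      ∑[ y < b ] (m * #xCentres y)
        ≡⟨ sum-cong-≗ (λ y → ∑-const m (#xCentres y)) ⟨
      ∑[ y < b ] ∑[ l < m ] #xCentres y
        ≤⟨ ∑-mono-≤ (λ y → ∑-mono-≤ (#xCentres≤#layer y)) ⟩
      ∑[ y < b ] ∑[ l < m ] ∑[ x < a ] 𝟙 (inD x y l)
        ≡⟨ sum-cong-≗ (λ y → ∑-comm (λ l x → 𝟙 (inD x y l))) ⟩
      ∑[ y < b ] ∑[ x < a ] ∑[ l < m ] 𝟙 (inD x y l)
        ≡⟨ ∑-comm (λ y x → ∑[ l < m ] 𝟙 (inD x y l)) ⟩
      #D ∎

    counting-bound : m * (k * g) ≤ suc m * #D
    counting-bound = begin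
      m * (k * g)                          ≤⟨ *-monoʳ-≤ m k*g≤#D+∑#xCentres ⟩
      m * (#D + ∑[ y < b ] #xCentres y)    ≡⟨ *-distribˡ-+ m #D _ ⟩
      m * #D + m * ∑[ y < b ] #xCentres y  ≤⟨ +-monoʳ-≤ (m * #D) m*∑#xCentres≤#D ⟩
      m * #D + #D                          ≡⟨ +-comm (m * #D) #D ⟩
      suc m * #D                           ∎

Dominates : (G : Graph) → Fin (n G) → Fin (n G) → Set
Dominates G u v = u ≡ v ⊎ Adj G u v

dominator : ∀ G {S} → Dominating G S → ∀ v → ∃ λ u → u ∈ S × Dominates G u v
dominator G dom v with dom v
... | inj₁ v∈S              = v , v∈S , inj₁ refl
... | inj₂ (u , u∈S , u~v)  = u , u∈S , inj₂ u~v

dominating : ∀ G {S} → (∀ v → ∃ λ u → u ∈ S × Dominates G u v) → Dominating G S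
dominating G has-dominator v with has-dominator v
... | u , u∈S , inj₁ refl = inj₁ u∈S
... | u , u∈S , inj₂ u~v  = inj₂ (u , u∈S , u~v)

module _ (G H : Graph) where

  fstV-combine : ∀ (g : Fin (n G)) (h : Fin (n H)) → fstV G H (combine g h) ≡ g
  fstV-combine g h = cong proj₁ (remQuot-combine g h)

  sndV-combine : ∀ (g : Fin (n G)) (h : Fin (n H)) → sndV G H (combine g h) ≡ h
  sndV-combine g h = cong proj₂ (remQuot-combine g h)

  combine-fstV-sndV : ∀ u → combine (fstV G H u) (sndV G H u) ≡ u
  combine-fstV-sndV = combine-remQuot {n G} (n H)

  □-adj : ∀ {g g' : Fin (n G)} {h h' : Fin (n H)} → Adj (G □ H) (combine g' h') (combine g h) →
          (g' ≡ g × Adj H h' h) ⊎ (h' ≡ h × Adj G g' g)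
  □-adj {g} {g'} {h} {h'} (inj₁ (g'≡g , h'~h)) =
    inj₁ (subst₂ _≡_ (fstV-combine g' h') (fstV-combine g h) g'≡g ,
          subst₂ (Adj H) (sndV-combine g' h') (sndV-combine g h) h'~h)
  □-adj {g} {g'} {h} {h'} (inj₂ (h'≡h , g'~g)) =
    inj₂ (subst₂ _≡_ (sndV-combine g' h') (sndV-combine g h) h'≡h ,
          subst₂ (Adj G) (fstV-combine g' h') (fstV-combine g h) g'~g)

  □-dominates : ∀ {g g' : Fin (n G)} {h h' : Fin (n H)} →
                Dominates (G □ H) (combine g' h') (combine g h) →
                (g' ≡ g × Dominates H h' h) ⊎ (h' ≡ h × Adj G g' g)
  □-dominates {g} {g'} {h} {h'} (inj₁ eq) with combine-injective g' h' g h eq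
  ... | g'≡g , h'≡h = inj₁ (g'≡g , inj₁ h'≡h)
  □-dominates (inj₂ adj) with □-adj adj
  ... | inj₁ (g'≡g , h'~h) = inj₁ (g'≡g , inj₂ h'~h)
  ... | inj₂ x             = inj₂ x

module TripleProduct (X Y Z : Graph) where

  vertex : Fin (n X) → Fin (n Y) → Fin (n Z) → Fin (n (X □ Y □ Z))
  vertex x y l = combine (combine x y) l

  xOf : Fin (n (X □ Y □ Z)) → Fin (n X)
  xOf u = fstV X Y (fstV (X □ Y) Z u)

  yOf : Fin (n (X □ Y □ Z)) → Fin (n Y)
  yOf u = sndV X Y (fstV (X □ Y) Z u)

  zOf : Fin (n (X □ Y □ Z)) → Fin (n Z)
  zOf u = sndV (X □ Y) Z u

  vertex-of : ∀ u → vertex (xOf u) (yOf u) (zOf u) ≡ u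
  vertex-of u = trans (cong (λ w → combine w (zOf u)) (combine-fstV-sndV X Y (fstV (X □ Y) Z u)))
                      (combine-fstV-sndV (X □ Y) Z u)

  ∣p∣≡∑∑∑𝟙 : (p : Subset (n (X □ Y □ Z))) →
            ∣ p ∣ ≡ ∑[ x < n X ] ∑[ y < n Y ] ∑[ l < n Z ] 𝟙 (lookup p (vertex x y l))
  ∣p∣≡∑∑∑𝟙 p = trans (∣p∣≡∑𝟙 p) (trans (∑-combine (n X * n Y) (n Z) (𝟙 ∘ lookup p))
                      (∑-combine (n X) (n Y) λ w → ∑[ l < n Z ] 𝟙 (lookup p (combine w l))))

  vertex-dominates : ∀ {x x' y y' l l'} → Dominates (X □ Y □ Z) (vertex x' y' l') (vertex x y l) →
                     (x' ≡ x × Dominates Y y' y) ⊎ (y' ≡ y × l' ≡ l × Adj X x' x)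
  vertex-dominates u↝v with □-dominates (X □ Y) Z u↝v
  ... | inj₁ (w'≡w , _) with combine-injective _ _ _ _ w'≡w
  ...   | x'≡x , y'≡y = inj₁ (x'≡x , inj₁ y'≡y)
  vertex-dominates u↝v | inj₂ (l'≡l , w'~w) with □-adj X Y w'~w
  ...   | inj₁ (x'≡x , y'~y) = inj₁ (x'≡x , inj₂ y'~y)
  ...   | inj₂ (y'≡y , x'~x) = inj₂ (y'≡y , l'≡l , x'~x)

  module _ (D : Subset (n (X □ Y □ Z))) where

    FibreDominated : Fin (n X) → Fin (n Y) → Fin (n Z) → Set
    FibreDominated x y l = ∃₂ λ y' l' → vertex x y' l' ∈ D × Dominates Y y' y

    XDominated : Fin (n X) → Fin (n Y) → Fin (n Z) → Set
    XDominated x y l = ∃ λ x' → vertex x' y l ∈ D × Adj X x' x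

    dominated : Dominating (X □ Y □ Z) D → ∀ x y l → FibreDominated x y l ⊎ XDominated x y l
    dominated domD x y l with dominator (X □ Y □ Z) domD (vertex x y l)
    ... | u , u∈D , u↝v rewrite sym (vertex-of u) = by-dominator u∈D u↝v
      where
      by-dominator : ∀ {x' y' l'} → vertex x' y' l' ∈ D →
                     Dominates (X □ Y □ Z) (vertex x' y' l') (vertex x y l) →
                     FibreDominated x y l ⊎ XDominated x y l
      by-dominator {x'} {y'} {l'} u∈D u↝v with vertex-dominates {x} {x'} {y} {y'} {l} {l'} u↝v
      ... | inj₁ (refl , y'↝y)        = inj₁ (_ , _ , u∈D , y'↝y)
      ... | inj₂ (refl , refl , x'~x) = inj₂ (_ , u∈D , x'~x)

module CellDecomposition (X Y Z : Graph) {SX : Subset (n X)} (domX : Dominating X SX)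
            {D : Subset (n (X □ Y □ Z))} (domD : Dominating (X □ Y □ Z) D) where

  open TripleProduct X Y Z public

  centre : Fin (n X) → Fin (n X)
  centre x = proj₁ (dominator X domX x)

  centre∈SX : ∀ x → lookup SX (centre x) ≡ true
  centre∈SX x = []=⇒lookup (proj₁ (proj₂ (dominator X domX x)))

  centre-dominates : ∀ x → Dominates X (centre x) x
  centre-dominates x = proj₂ (proj₂ (dominator X domX x))

  inD : Fin (n X) → Fin (n Y) → Fin (n Z) → Bool
  inD x y l = lookup D (vertex x y l)

  -- Adjacency need not be decidable, so the classification reads off the dominator chosen by domD.
  fibreDominated : Fin (n X) → Fin (n Y) → Fin (n Z) → Bool
  fibreDominated x y l with dominated D domD x y l
  ... | inj₁ _ = true
  ... | inj₂ _ = false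

  fibreDominated-true : ∀ {x y l} → fibreDominated x y l ≡ true → FibreDominated D x y l
  fibreDominated-true {x} {y} {l} _ with dominated D domD x y l
  fibreDominated-true () | inj₂ _
  ... | inj₁ fd = fd

  fibreDominated-false : ∀ {x y l} → fibreDominated x y l ≡ false → XDominated D x y l
  fibreDominated-false {x} {y} {l} _ with dominated D domD x y l
  fibreDominated-false () | inj₁ _
  ... | inj₂ xd = xd

  cellFibreDominated : Fin (n X) → Fin (n Y) → Bool
  cellFibreDominated c y = any λ x → does (centre x ≟ c) ∧ any (fibreDominated x y)

  open Counting inD (lookup SX) centre cellFibreDominated public

  Ydom-dominating : ∀ c → Dominating Y (Ydom c)
  Ydom-dominating c = dominating Y reach
    where
    reach : ∀ y → ∃ λ y' → y' ∈ Ydom c × Dominates Y y' y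
    reach y with cellFibreDominated c y in cellF
    ... | false = y , ∈-tabulate⁺ _ (∨-trueʳ (cellOccupied c y) (cong not cellF)) , inj₁ refl
    ... | true with any⁻ (λ x → does (centre x ≟ c) ∧ any (fibreDominated x y)) cellF
    ...   | x , x∈c∧fd
          with any⁻ (fibreDominated x y) (∧-conicalʳ _ (any (fibreDominated x y)) x∈c∧fd)
    ...     | l , fd with fibreDominated-true fd
    ...       | y' , l' , v∈D , y'↝y = y' , ∈-tabulate⁺ _ (∨-trueˡ _ occ) , y'↝y
      where
      occ : cellOccupied c y' ≡ true
      occ = any⁺ _ x (∧-true (∧-conicalˡ _ (any (fibreDominated x y)) x∈c∧fd)
                             (any⁺ (inD x y') l' ([]=⇒lookup v∈D)))

  Xdom-dominating : ∀ y l → Dominating X (Xdom y l)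
  Xdom-dominating y l = dominating X reach
    where
    reach : ∀ x → ∃ λ x' → x' ∈ Xdom y l × Dominates X x' x
    reach x with cellFibreDominated (centre x) y in cellF | fibreDominated x y l in fd
    ... | true  | _ =
      centre x , ∈-tabulate⁺ _ (∨-trueʳ _ (∧-true (centre∈SX x) cellF)) , centre-dominates x
    ... | false | true = contradiction (trans (sym cellF) cell) λ ()
      where
      cell : cellFibreDominated (centre x) y ≡ true
      cell = any⁺ _ x (∧-true (dec-true (centre x ≟ centre x) refl) (any⁺ (fibreDominated x y) l fd))
    ... | false | false with fibreDominated-false fd
    ...   | x' , v∈D , x'~x = x' , ∈-tabulate⁺ _ (∨-trueˡ _ ([]=⇒lookup v∈D)) , inj₂ x'~x

γ-□-□-lower-bound : (X Y Z : Graph) {gX gY g : ℕ} →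
  IsDominationNumber X gX → IsDominationNumber Y gY → IsDominationNumber (X □ Y □ Z) g →
  n Z * (gX * gY) ≤ suc (n Z) * g
γ-□-□-lower-bound X Y Z ((SX , domX , ∣SX∣≡gX) , minX) (_ , minY) ((D , domD , ∣D∣≡g) , _) =
  subst (λ t → n Z * _ ≤ suc (n Z) * t) (trans (sym (∣p∣≡∑∑∑𝟙 D)) ∣D∣≡g)
    (counting-bound (trans (sym (∣p∣≡∑𝟙 SX)) ∣SX∣≡gX)
                    (λ c _ → minY (Ydom c) (Ydom-dominating c))
                    (λ y l → minX (Xdom y l) (Xdom-dominating y l)))
  where open CellDecomposition X Y Z domX domD

theorem2 : (X Y : Graph) (gX gY gXYP : ℕ) →
    IsDominationNumber X gX → IsDominationNumber Y gY →
    IsDominationNumber (X □ Y □ P 2) gXYP →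
    2 * (gX * gY) ≤ 3 * gXYP
theorem2 X Y gX gY gXYP = γ-□-□-lower-bound X Y (P 2)
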